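{- Let $p$ be a pattern of length $\ell\ge qs$ with period $s$. Then every letter occurring in $p$ occurs among the first $qs$ letters of $p$.
   Context: Let $\mathcal{A}$ be a finite alphabet with $q$ letters and $G$ a subgroup of the symmetric group on $\mathcal{A}$, acting on words letterwise. A pattern is a $G$-orbit of words, represented by its lexicographically least word $p=p(1)\cdots p(\ell)$, with $p(i,j)=p(i)\cdots p(j)$. A pattern $p$ of length $\ell$ has period $i$ ($1\le i\le\ell-1$) if there exists $g\in G$ with $g\cdot p(1,\ell-i)=p(i+1,\ell)$. -}

module Defs where

open import Data.Nat using (ℕ; _+_; _<_; _≤_; _∸_)
open import Data.Fin using (Fin; toℕ)
import Data.Fin as F
open import Data.Fin.Permutation using (Permutation′; _⟨$⟩ʳ_; id; flip; _∘ₚ_; _≈_)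
open import Data.Product using (Σ; _×_; ∃)
open import Data.Sum using (_⊎_)
open import Relation.Binary.PropositionalEquality using (_≡_)

-- Alphabet 𝒜 = Fin q (q letters, ordered by the order on Fin q).
-- A word of length ℓ is a function Fin ℓ → Fin q (positions are 0-based).
Word : ℕ → ℕ → Set
Word q ℓ = Fin ℓ → Fin q

record IsSubgroup {q : ℕ} (G : Permutation′ q → Set) : Set where
  field
    resp  : ∀ {π ρ} → π ≈ ρ → G π → G ρ
    id∈   : G id
    ∘∈    : ∀ {π ρ} → G π → G ρ → G (π ∘ₚ ρ)
    inv∈  : ∀ {π} → G π → G (flip π)

act : ∀ {q ℓ} → Permutation′ q → Word q ℓ → Word q ℓ
act g w i = g ⟨$⟩ʳ w i

LexLeq : ∀ {q ℓ} → Word q ℓ → Word q ℓ → Set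
LexLeq {q} {ℓ} v w =
  (∀ i → v i ≡ w i) ⊎
  (Σ (Fin ℓ) λ k → (∀ i → toℕ i < toℕ k → v i ≡ w i) × (v k F.< w k))

IsPattern : ∀ {q ℓ} → (Permutation′ q → Set) → Word q ℓ → Set
IsPattern G p = ∀ g → G g → LexLeq p (act g p)

-- p has period s: 1 ≤ s ≤ ℓ-1 and some g ∈ G maps p(1,ℓ-s) onto p(s+1,ℓ),
-- i.e. g(p(i)) = p(i+s) for all (0-based) positions i with i+s < ℓ.
HasPeriod : ∀ {q ℓ} → (Permutation′ q → Set) → Word q ℓ → ℕ → Set
HasPeriod {q} {ℓ} G p s =
  1 ≤ s × s ≤ ℓ ∸ 1 ×
  Σ (Permutation′ q) λ g → G g ×
    (∀ (i j : Fin ℓ) → toℕ j ≡ toℕ i + s → g ⟨$⟩ʳ p i ≡ p j)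

-- Along a period s the letters p(x), p(x + s), p(x + 2s), … are the images of p(x) under
-- g, g², …, so two positions carrying the same letter keep doing so after equal shifts by
-- multiples of s. For a position j ≥ qs, the q + 1 positions j − qs, j − (q−1)s, …, j
-- carry only q letters; shifting a coincidence p(j − qs + as) = p(j − qs + bs), a < b,
-- forward by (q − b)s yields an earlier position carrying p(j). Descending this way ends
-- inside the prefix of length qs.
module Submission where

open import Defs
open import Data.Nat using (ℕ; zero; suc; _*_; _+_; _∸_; _≤_; _<_; NonZero; s≤s; s≤s⁻¹)
open import Data.Nat.Properties
open import Data.Fin using (Fin; toℕ; fromℕ<) renaming (_<_ to _<ᶠ_)
open import Data.Fin.Properties using (toℕ<n; toℕ-fromℕ<; toℕ-injective; pigeonhole)
open import Data.Fin.Induction using (<-wellFounded)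
open import Data.Fin.Permutation using (Permutation′; _⟨$⟩ʳ_)
open import Data.Product using (Σ; _×_; _,_)
open import Induction.WellFounded using (Acc; acc)
open import Relation.Nullary using (yes; no)
open import Relation.Binary.PropositionalEquality

Periodic : ∀ {q ℓ} → Permutation′ q → ℕ → Word q ℓ → Set
Periodic {ℓ = ℓ} g s p = ∀ (i j : Fin ℓ) → toℕ j ≡ toℕ i + s → g ⟨$⟩ʳ p i ≡ p j

fromℕ-below : ∀ {ℓ n} (x : Fin ℓ) → n ≤ toℕ x → Fin ℓ
fromℕ-below x n≤x = fromℕ< (≤-<-trans n≤x (toℕ<n x))

toℕ-fromℕ-below : ∀ {ℓ n} (x : Fin ℓ) (n≤x : n ≤ toℕ x) → toℕ (fromℕ-below x n≤x) ≡ n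
toℕ-fromℕ-below x n≤x = toℕ-fromℕ< _

occurs-in-prefix : ∀ {A : Set} {ℓ m} (p : Fin ℓ → A) →
                   (∀ j → m ≤ toℕ j → Σ (Fin ℓ) λ i → toℕ i < toℕ j × p i ≡ p j) →
                   ∀ j → Σ (Fin ℓ) λ i → toℕ i < m × p i ≡ p j
occurs-in-prefix {m = m} p earlier j = descend j (<-wellFounded j)
  where
  descend : ∀ j → Acc _<ᶠ_ j → Σ (Fin _) λ i → toℕ i < m × p i ≡ p j
  descend j (acc rec) with toℕ j <? m
  ... | yes j<m = j , j<m , refl
  ... | no  j≮m with earlier j (≮⇒≥ j≮m)
  ...   | i , i<j , pi≡pj with descend i (rec i<j)
  ...     | k , k<m , pk≡pi = k , k<m , trans pk≡pi pi≡pj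

module _ {q ℓ s} (g : Permutation′ q) {p : Word q ℓ} (periodic : Periodic g s p) where

  equal-letters-shift : ∀ t {x y x′ y′ : Fin ℓ} →
                        toℕ x′ ≡ toℕ x + t * s → toℕ y′ ≡ toℕ y + t * s →
                        p x ≡ p y → p x′ ≡ p y′
  equal-letters-shift zero {x} {y} x′≡ y′≡ px≡py = begin
    p _ ≡⟨ cong p (toℕ-injective (trans x′≡ (+-identityʳ (toℕ x)))) ⟩
    p x ≡⟨ px≡py ⟩
    p y ≡⟨ cong p (toℕ-injective (sym (trans y′≡ (+-identityʳ (toℕ y))))) ⟩
    p _ ∎
    where open ≡-Reasoning
  equal-letters-shift (suc t) {x} {y} {x′} {y′} x′≡ y′≡ px≡py =
    equal-letters-shift t (rest x′≡) (rest y′≡) px+s≡py+s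
    where
    s-below : ∀ {z z′ : Fin ℓ} → toℕ z′ ≡ toℕ z + suc t * s → toℕ z + s ≤ toℕ z′
    s-below {z} z′≡ = ≤-trans (+-monoʳ-≤ (toℕ z) (m≤m+n s (t * s))) (≤-reflexive (sym z′≡))
    rest : ∀ {z z′ : Fin ℓ} (z′≡ : toℕ z′ ≡ toℕ z + suc t * s) →
           toℕ z′ ≡ toℕ (fromℕ-below z′ (s-below z′≡)) + t * s
    rest {z} {z′} z′≡ = begin
      toℕ z′                                   ≡⟨ z′≡ ⟩
      toℕ z + (s + t * s)                      ≡⟨ +-assoc (toℕ z) s (t * s) ⟨
      toℕ z + s + t * s                        ≡⟨ cong (_+ t * s) (toℕ-fromℕ-below z′ (s-below z′≡)) ⟨
      toℕ (fromℕ-below z′ (s-below z′≡)) + t * s ∎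
      where open ≡-Reasoning
    px+s≡py+s : p (fromℕ-below x′ (s-below x′≡)) ≡ p (fromℕ-below y′ (s-below y′≡))
    px+s≡py+s = trans (sym (periodic x _ (toℕ-fromℕ-below x′ (s-below x′≡))))
                      (trans (cong (g ⟨$⟩ʳ_) px≡py) (periodic y _ (toℕ-fromℕ-below y′ (s-below y′≡))))

  progression-bound : ∀ (j : Fin ℓ) → q * s ≤ toℕ j → (k : Fin (suc q)) →
                      toℕ j ∸ q * s + toℕ k * s ≤ toℕ j
  progression-bound j qs≤j k =
    ≤-trans (+-monoʳ-≤ (toℕ j ∸ q * s) (*-monoˡ-≤ s (s≤s⁻¹ (toℕ<n k))))
            (≤-reflexive (m∸n+n≡m qs≤j))

  progression-below : (j : Fin ℓ) → q * s ≤ toℕ j → Fin (suc q) → Fin ℓ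
  progression-below j qs≤j k = fromℕ-below j (progression-bound j qs≤j k)

  toℕ-progression-below : ∀ j qs≤j k → toℕ (progression-below j qs≤j k) ≡ toℕ j ∸ q * s + toℕ k * s
  toℕ-progression-below j qs≤j k = toℕ-fromℕ-below j (progression-bound j qs≤j k)

  earlier-occurrence : .{{NonZero s}} → ∀ j → q * s ≤ toℕ j →
                       Σ (Fin ℓ) λ i → toℕ i < toℕ j × p i ≡ p j
  earlier-occurrence j qs≤j
    with a , b , a<b , pa≡pb ← pigeonhole (n<1+n q) (λ k → p (progression-below j qs≤j k)) =
    fromℕ-below j (<⇒≤ i<j) , subst (_< toℕ j) (sym (toℕ-fromℕ-below j (<⇒≤ i<j))) i<j ,
    equal-letters-shift t (shifted a (toℕ-fromℕ-below j (<⇒≤ i<j))) (shifted b j≡) pa≡pb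
    where
    open ≡-Reasoning
    r = toℕ j ∸ q * s
    t = q ∸ toℕ b
    b+t≡q : toℕ b + t ≡ q
    b+t≡q = m+[n∸m]≡n (s≤s⁻¹ (toℕ<n b))
    i<j : r + (toℕ a + t) * s < toℕ j
    i<j = ≤-trans (+-monoʳ-< r (*-monoˡ-< s (≤-trans (+-monoˡ-< t a<b) (≤-reflexive b+t≡q))))
                  (≤-reflexive (m∸n+n≡m qs≤j))
    j≡ : toℕ j ≡ r + (toℕ b + t) * s
    j≡ = begin
      toℕ j                 ≡⟨ m∸n+n≡m qs≤j ⟨
      r + q * s             ≡⟨ cong (λ n → r + n * s) b+t≡q ⟨
      r + (toℕ b + t) * s   ∎
    shifted : ∀ k {x : Fin ℓ} → toℕ x ≡ r + (toℕ k + t) * s →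
              toℕ x ≡ toℕ (progression-below j qs≤j k) + t * s
    shifted k {x} x≡ = begin
      toℕ x                                      ≡⟨ x≡ ⟩
      r + (toℕ k + t) * s                        ≡⟨ cong (r +_) (*-distribʳ-+ s (toℕ k) t) ⟩
      r + (toℕ k * s + t * s)                    ≡⟨ +-assoc r _ _ ⟨
      r + toℕ k * s + t * s                      ≡⟨ cong (_+ t * s) (toℕ-progression-below j qs≤j k) ⟨
      toℕ (progression-below j qs≤j k) + t * s   ∎

mainTheorem18 : (q : ℕ) (G : Permutation′ q → Set) → IsSubgroup G →
                (ℓ s : ℕ) (p : Word q ℓ) → IsPattern G p → HasPeriod G p s →
                q * s ≤ ℓ →
                ∀ (j : Fin ℓ) → Σ (Fin ℓ) λ i → toℕ i < q * s × p i ≡ p j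
mainTheorem18 q G _ ℓ (suc s) p _ (s≤s _ , _ , g , _ , periodic) _ =
  occurs-in-prefix p (earlier-occurrence g periodic)
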